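{- Fix a prime $p$ and $k\in\mathbb{N}$. Let $\alpha_1,\ldots,\alpha_n,\beta\in\mathbb{F}_{p^k}$ be such that $\sum_{i=1}^n\alpha_ia_i-\beta\neq0$ for every $\mathbf{a}\in\{0,1\}^n$. If $f\in\mathbb{F}_{p^k}[x_1,\ldots,x_n]$ is a multilinear polynomial with $f(\mathbf{a})=1/(\sum_{i=1}^n\alpha_ia_i-\beta)$ for all $\mathbf{a}\in\{0,1\}^n$, then $\deg(f)\le k\cdot(p-1)$. -}

module Defs where

open import Level using (Level; _⊔_) renaming (suc to lsuc)
open import Data.Nat using (ℕ; zero; suc; _^_; _<_)
open import Data.Bool using (Bool; true; false; if_then_else_)
open import Data.Fin using (Fin)
open import Data.Vec using (Vec; []; _∷_)
open import Data.List using (List) renaming ([] to []ᴸ; _∷_ to _∷ᴸ_)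
import Data.List as L
open import Data.Product using (Σ; _×_; _,_)
open import Relation.Binary.PropositionalEquality using (_≡_)
open import Relation.Nullary using (¬_)
open import Algebra.Bundles using (CommutativeRing)

record IsField {c ℓ} (R : CommutativeRing c ℓ) : Set (c ⊔ ℓ) where
  open CommutativeRing R
  field
    0≉1     : ¬ (0# ≈ 1#)
    inverse : ∀ x → ¬ (x ≈ 0#) → Σ Carrier λ y → x * y ≈ 1#

record HasCardinality {c ℓ} (R : CommutativeRing c ℓ) (N : ℕ) : Set (c ⊔ ℓ) where
  open CommutativeRing R
  field
    toFin      : Carrier → Fin N
    fromFin    : Fin N → Carrier
    toFin-cong : ∀ {x y} → x ≈ y → toFin x ≡ toFin y
    from-to    : ∀ x → fromFin (toFin x) ≈ x
    to-from    : ∀ i → toFin (fromFin i) ≡ i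

-- A finite field of order q (q = p^k below): F_q is unique up to isomorphism.
record FiniteField c ℓ (q : ℕ) : Set (lsuc (c ⊔ ℓ)) where
  field
    commRing    : CommutativeRing c ℓ
    isField     : IsField commRing
    cardinality : HasCardinality commRing q
  open CommutativeRing commRing public

allBoolVecs : (n : ℕ) → List (Vec Bool n)
allBoolVecs zero    = [] ∷ᴸ []ᴸ
allBoolVecs (suc n) = L.map (false ∷_) (allBoolVecs n) L.++ L.map (true ∷_) (allBoolVecs n)

weight : ∀ {n} → Vec Bool n → ℕ
weight []           = zero
weight (false ∷ bs) = weight bs
weight (true  ∷ bs) = suc (weight bs)

module Poly {c ℓ} (R : CommutativeRing c ℓ) where
  open CommutativeRing R

  sumL : List Carrier → Carrier
  sumL = L.foldr _+_ 0#

  -- A multilinear polynomial in x_1..x_n: a coefficient for each monomial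
  -- x^S = ∏_{i ∈ S} x_i, with S ⊆ {1..n} encoded as a Bool vector.
  Multilinear : ℕ → Set c
  Multilinear n = Vec Bool n → Carrier

  monomial : ∀ {n} → Vec Bool n → Vec Carrier n → Carrier
  monomial []           []       = 1#
  monomial (false ∷ S)  (x ∷ xs) = monomial S xs
  monomial (true  ∷ S)  (x ∷ xs) = x * monomial S xs

  eval : ∀ {n} → Multilinear n → Vec Carrier n → Carrier
  eval {n} f x = sumL (L.map (λ S → f S * monomial S x) (allBoolVecs n))

  bit : Bool → Carrier
  bit false = 0#
  bit true  = 1#

  linComb : ∀ {n} → Vec Carrier n → Vec Bool n → Carrier
  linComb []       []       = 0#
  linComb (α ∷ αs) (a ∷ as) = α * bit a + linComb αs as

  DegreeAtMost : ∀ {n} → Multilinear n → ℕ → Set ℓ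
  DegreeAtMost {n} f d = ∀ (S : Vec Bool n) → d < weight S → f S ≈ 0#

-- On the cube z a = Σ αᵢ aᵢ - β never vanishes, so by Fermat's little theorem in the field of
-- order q = p ^ k the values of f are z ^ (q - 2). Measure the degree of a function on {0,1}ⁿ by
-- iterated finite differences: it is subadditive under products and, because x ↦ x ^ p is
-- additive in characteristic p, not increased by p-th powers. Since deg z ≤ 1 and
--   q - 2 = (p - 2) + p (p ^ (k - 1) - 1),   p ^ (j + 1) - 1 = (p - 1) + p (p ^ j - 1),
-- this gives deg z ^ (q - 2) ≤ (p - 2) + (k - 1) (p - 1) ≤ k (p - 1). Finally, the iterated
-- differences of a multilinear polynomial at 0 are its coefficients, so those above that degree vanish.
module Submission where

open import Defs
open import Data.Nat using (ℕ; _^_; _∸_) renaming (_*_ to _*ℕ_)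
open import Data.Nat.Primality using (Prime)
open import Data.Vec using (Vec; map)
open import Data.Bool using (Bool)
open import Relation.Nullary using (¬_)

open import Level using (_⊔_)
open import Data.Empty using (⊥-elim)
open import Data.Sum using (inj₁; inj₂)
open import Data.Product using (proj₁; proj₂)
open import Data.Bool using (true; false)
open import Data.Nat using (zero; suc; pred; _≤_; _<_; z≤n; s≤s; >-nonZero; nonTrivial⇒n>1) renaming (_+_ to _+ℕ_)
import Data.Nat.Properties as ℕ
open import Data.Nat.Combinatorics using (_C_; nCn≡1; nC1≡n; k>n⇒nCk≡0; nCk+nC[k+1]≡[n+1]C[k+1])
open import Data.Nat.Divisibility using (_∣_; divides; ∣⇒≤)
open import Data.Nat.Primality using (euclidsLemma; prime⇒nonTrivial)
open import Data.Nat.Tactic.RingSolver using (solve-∀)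
open import Data.Fin using (Fin; toℕ; inject₁; fromℕ; punchIn) renaming (zero to fzero; suc to fsuc)
import Data.Fin.Properties as Fin
open import Data.Fin.Permutation as Permutation using (Permutation; permutation; _⟨$⟩ʳ_)
open import Data.Vec using ([]; _∷_)
import Data.List as List
import Data.List.Properties as List
open import Relation.Nullary using (yes; no)
open import Relation.Binary.Definitions using (Decidable)
open import Relation.Binary.PropositionalEquality as ≡ using (_≡_; cong; cong₂)
open import Algebra.Bundles using (CommutativeRing)
import Algebra.Properties.CommutativeMonoid.Sum as CommutativeMonoidSum

[1+k]*[1+n]C[1+k]≡[1+n]*nCk : ∀ n k → suc k *ℕ (suc n C suc k) ≡ suc n *ℕ (n C k)
[1+k]*[1+n]C[1+k]≡[1+n]*nCk zero zero = ≡.refl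
[1+k]*[1+n]C[1+k]≡[1+n]*nCk zero (suc k)
  rewrite k>n⇒nCk≡0 {1} {suc (suc k)} (s≤s (s≤s z≤n)) | k>n⇒nCk≡0 {0} {suc k} (s≤s z≤n) = ℕ.*-zeroʳ k
[1+k]*[1+n]C[1+k]≡[1+n]*nCk (suc n) zero rewrite nC1≡n (suc (suc n)) =
  ≡.trans (ℕ.+-identityʳ (suc (suc n))) (≡.sym (ℕ.*-identityʳ (suc (suc n))))
[1+k]*[1+n]C[1+k]≡[1+n]*nCk (suc n) (suc k) = begin
  suc (suc k) *ℕ (suc (suc n) C suc (suc k))       ≡⟨ cong (suc (suc k) *ℕ_) (≡.sym (nCk+nC[k+1]≡[n+1]C[k+1] (suc n) (suc k))) ⟩
  suc (suc k) *ℕ (A +ℕ B)                         ≡⟨ ℕ.*-distribˡ-+ (suc (suc k)) A B ⟩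
  (A +ℕ suc k *ℕ A) +ℕ suc (suc k) *ℕ B           ≡⟨ cong₂ (λ u w → (A +ℕ u) +ℕ w) ([1+k]*[1+n]C[1+k]≡[1+n]*nCk n k)
                                                                                    ([1+k]*[1+n]C[1+k]≡[1+n]*nCk n (suc k)) ⟩
  (A +ℕ suc n *ℕ (n C k)) +ℕ suc n *ℕ (n C suc k)  ≡⟨ ℕ.+-assoc A _ _ ⟩
  A +ℕ (suc n *ℕ (n C k) +ℕ suc n *ℕ (n C suc k))  ≡⟨ cong (A +ℕ_) (≡.sym (ℕ.*-distribˡ-+ (suc n) (n C k) (n C suc k))) ⟩
  A +ℕ suc n *ℕ (n C k +ℕ n C suc k)               ≡⟨ cong (λ u → A +ℕ suc n *ℕ u) (nCk+nC[k+1]≡[n+1]C[k+1] n k) ⟩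
  A +ℕ suc n *ℕ A                                  ∎
  where
  open ≡.≡-Reasoning
  A = suc n C suc k
  B = suc n C suc (suc k)

prime∣pCk : ∀ {p k} → Prime p → 0 < k → k < p → p ∣ p C k
prime∣pCk {suc n} {suc k} p-prime _ k<p
  with euclidsLemma (suc k) (suc n C suc k) p-prime
         (divides (n C k) (≡.trans ([1+k]*[1+n]C[1+k]≡[1+n]*nCk n k) (ℕ.*-comm (suc n) (n C k))))
... | inj₁ p∣1+k = ⊥-elim (ℕ.<⇒≱ k<p (∣⇒≤ p∣1+k))
... | inj₂ p∣pCk = p∣pCk

1≤m^n : ∀ {m} → 1 ≤ m → ∀ n → 1 ≤ m ^ n
1≤m^n {m} 1≤m n = ℕ.m^n>0 m {{>-nonZero 1≤m}} n

suc[n∸2]≡n∸1 : ∀ {n} → 2 ≤ n → suc (n ∸ 2) ≡ n ∸ 1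
suc[n∸2]≡n∸1 (s≤s (s≤s _)) = ≡.refl

m*n∸1≡[m∸1]+[n∸1]*m : ∀ {m n} → 1 ≤ m → 1 ≤ n → m *ℕ n ∸ 1 ≡ (m ∸ 1) +ℕ (n ∸ 1) *ℕ m
m*n∸1≡[m∸1]+[n∸1]*m {suc a} {suc b} _ _ = lemma a b
  where
  lemma : ∀ a b → b +ℕ a *ℕ suc b ≡ a +ℕ b *ℕ suc a
  lemma = solve-∀

m*n∸2≡[m∸2]+[n∸1]*m : ∀ {m n} → 2 ≤ m → 1 ≤ n → m *ℕ n ∸ 2 ≡ (m ∸ 2) +ℕ (n ∸ 1) *ℕ m
m*n∸2≡[m∸2]+[n∸1]*m {m@(suc (suc a))} {n} (s≤s _) 1≤n = begin
  m *ℕ n ∸ 2                         ≡⟨ ≡.sym (ℕ.∸-+-assoc (m *ℕ n) 1 1) ⟩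
  m *ℕ n ∸ 1 ∸ 1                     ≡⟨ cong (_∸ 1) (m*n∸1≡[m∸1]+[n∸1]*m (s≤s z≤n) 1≤n) ⟩
  (suc a +ℕ (n ∸ 1) *ℕ m) ∸ 1        ≡⟨ ℕ.+-∸-comm ((n ∸ 1) *ℕ m) (s≤s z≤n) ⟩
  a +ℕ (n ∸ 1) *ℕ m                  ∎
  where open ≡.≡-Reasoning

distinct⇒2≤n : ∀ {n} {i j : Fin n} → ¬ i ≡ j → 2 ≤ n
distinct⇒2≤n {suc zero}    {fzero} {fzero} i≢j = ⊥-elim (i≢j ≡.refl)
distinct⇒2≤n {suc (suc n)}                 _   = s≤s (s≤s z≤n)

-- If u has degree < a and v has degree < b then u * v has degree < a ⊗ b;
-- 0 is absorbing because the zero function is the only one of degree < 0.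
infixl 7 _⊗_
_⊗_ : ℕ → ℕ → ℕ
zero  ⊗ b     = zero
suc a ⊗ zero  = zero
suc a ⊗ suc b = suc (a +ℕ b)

pred-⊗ˡ : ∀ a b → pred a ⊗ b ≤ pred (a ⊗ b)
pred-⊗ˡ zero          b       = z≤n
pred-⊗ˡ (suc zero)    b       = z≤n
pred-⊗ˡ (suc (suc a)) zero    = z≤n
pred-⊗ˡ (suc (suc a)) (suc b) = ℕ.≤-refl

pred-⊗ʳ : ∀ a b → a ⊗ pred b ≤ pred (a ⊗ b)
pred-⊗ʳ zero    b             = z≤n
pred-⊗ʳ (suc a) zero          = z≤n
pred-⊗ʳ (suc a) (suc zero)    = z≤n
pred-⊗ʳ (suc a) (suc (suc b)) = ℕ.≤-reflexive (≡.sym (ℕ.+-suc a b))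

module CubeDegree {c ℓ} (R : CommutativeRing c ℓ) where
  open CommutativeRing R
  open Poly R
  open import Algebra.Properties.AbelianGroup +-abelianGroup using (x≈z//y; //-rightDividesˡ; //-cong₂; ⁻¹-∙-comm)
  open import Algebra.Properties.Semiring.Exp semiring using (^-congˡ; ^-congʳ; ^-homo-*; ^-assocʳ) renaming (_^_ to _↑_)
  open import Algebra.Properties.CommutativeSemigroup *-commutativeSemigroup using (x∙yz≈y∙xz)
  open import Algebra.Solver.Ring.NaturalCoefficients.Default commutativeSemiring
  open import Relation.Binary.Reasoning.Setoid setoid

  x≈y+z⇒x-y≈z : ∀ {x y z} → x ≈ y + z → x - y ≈ z
  x≈y+z⇒x-y≈z {x} {y} {z} x≈y+z = sym (x≈z//y z y x (trans (+-comm z y) (sym x≈y+z)))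

  x≈y+[x-y] : ∀ x y → x ≈ y + (x - y)
  x≈y+[x-y] x y = trans (sym (//-rightDividesˡ y x)) (+-comm (x - y) y)

  face₀ : ∀ {n} → (Vec Bool (suc n) → Carrier) → Vec Bool n → Carrier
  face₀ v a = v (false ∷ a)

  Δ : ∀ {n} → (Vec Bool (suc n) → Carrier) → Vec Bool n → Carrier
  Δ v a = v (true ∷ a) - v (false ∷ a)

  -- Degree < L of the multilinear interpolant of v, computed by finite differences in the first variable.
  data DegreeBelow : ∀ {n} → ℕ → (Vec Bool n → Carrier) → Set (c ⊔ ℓ) where
    vanishes : ∀ {v : Vec Bool 0 → Carrier} → v [] ≈ 0# → DegreeBelow 0 v
    constant : ∀ {L} {v : Vec Bool 0 → Carrier} → DegreeBelow (suc L) v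
    split    : ∀ {n L} {v : Vec Bool (suc n) → Carrier} →
               DegreeBelow L (face₀ v) → DegreeBelow (pred L) (Δ v) → DegreeBelow L v

  DegreeBelow-cong : ∀ {n L} {u v : Vec Bool n → Carrier} → (∀ a → u a ≈ v a) → DegreeBelow L u → DegreeBelow L v
  DegreeBelow-cong u≈v (vanishes u≈0) = vanishes (trans (sym (u≈v [])) u≈0)
  DegreeBelow-cong u≈v constant       = constant
  DegreeBelow-cong u≈v (split d₀ dΔ)  =
    split (DegreeBelow-cong (λ a → u≈v (false ∷ a)) d₀)
          (DegreeBelow-cong (λ a → //-cong₂ (u≈v (true ∷ a)) (u≈v (false ∷ a))) dΔ)

  DegreeBelow-0# : ∀ {n L} → DegreeBelow {n} L (λ _ → 0#)
  DegreeBelow-0# {zero}  {zero}  = vanishes refl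
  DegreeBelow-0# {zero}  {suc L} = constant
  DegreeBelow-0# {suc n}         = split DegreeBelow-0# (DegreeBelow-cong (λ _ → sym (-‿inverseʳ 0#)) DegreeBelow-0#)

  DegreeBelow-const : ∀ {n} x → DegreeBelow {n} 1 (λ _ → x)
  DegreeBelow-const {zero}  x = constant
  DegreeBelow-const {suc n} x = split (DegreeBelow-const x) (DegreeBelow-cong (λ _ → sym (-‿inverseʳ x)) DegreeBelow-0#)

  DegreeBelow-mono : ∀ {n L L′} {v : Vec Bool n → Carrier} → L ≤ L′ → DegreeBelow L v → DegreeBelow L′ v
  DegreeBelow-mono {L′ = zero}  z≤n  (vanishes v≈0) = vanishes v≈0
  DegreeBelow-mono {L′ = suc L′} _   (vanishes v≈0) = constant
  DegreeBelow-mono (s≤s _)           constant       = constant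
  DegreeBelow-mono L≤L′              (split d₀ dΔ)  = split (DegreeBelow-mono L≤L′ d₀) (DegreeBelow-mono (ℕ.pred-mono-≤ L≤L′) dΔ)

  DegreeBelow-+ : ∀ {n L} {u v : Vec Bool n → Carrier} →
                  DegreeBelow L u → DegreeBelow L v → DegreeBelow L (λ a → u a + v a)
  DegreeBelow-+ (vanishes u≈0) (vanishes v≈0) = vanishes (trans (+-cong u≈0 v≈0) (+-identityʳ 0#))
  DegreeBelow-+ constant       constant       = constant
  DegreeBelow-+ {u = u} {v} (split du₀ duΔ) (split dv₀ dvΔ) =
    split (DegreeBelow-+ du₀ dv₀)
          (DegreeBelow-cong (λ a → sym (Δ-+ (u (true ∷ a)) (u (false ∷ a)) (v (true ∷ a)) (v (false ∷ a))))
                            (DegreeBelow-+ duΔ dvΔ))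
    where
    Δ-+ : ∀ u₁ u₀ v₁ v₀ → (u₁ + v₁) - (u₀ + v₀) ≈ (u₁ - u₀) + (v₁ - v₀)
    Δ-+ u₁ u₀ v₁ v₀ = begin
      (u₁ + v₁) + - (u₀ + v₀)     ≈⟨ +-cong refl (sym (⁻¹-∙-comm u₀ v₀)) ⟩
      (u₁ + v₁) + (- u₀ + - v₀)   ≈⟨ solve 4 (λ a b c d → (a :+ b) :+ (c :+ d) := (a :+ c) :+ (b :+ d)) refl u₁ v₁ (- u₀) (- v₀) ⟩
      (u₁ - u₀) + (v₁ - v₀)       ∎

  DegreeBelow-face₁ : ∀ {n L} {v : Vec Bool (suc n) → Carrier} → DegreeBelow L v → DegreeBelow L (λ a → v (true ∷ a))
  DegreeBelow-face₁ {v = v} (split d₀ dΔ) =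
    DegreeBelow-cong (λ a → sym (x≈y+[x-y] (v (true ∷ a)) (v (false ∷ a))))
                     (DegreeBelow-+ d₀ (DegreeBelow-mono ℕ.pred[n]≤n dΔ))

  DegreeBelow-* : ∀ {n a b} {u v : Vec Bool n → Carrier} →
                  DegreeBelow a u → DegreeBelow b v → DegreeBelow (a ⊗ b) (λ x → u x * v x)
  DegreeBelow-* (vanishes u≈0) _              = vanishes (trans (*-cong u≈0 refl) (zeroˡ _))
  DegreeBelow-* constant       (vanishes v≈0) = vanishes (trans (*-cong refl v≈0) (zeroʳ _))
  DegreeBelow-* constant       constant       = constant
  DegreeBelow-* {a = a} {b} {u} {v} (split du₀ duΔ) dv@(split dv₀ dvΔ) =
    split (DegreeBelow-* du₀ dv₀)
          (DegreeBelow-cong (λ x → sym (Δ-* (u (true ∷ x)) (u (false ∷ x)) (v (true ∷ x)) (v (false ∷ x))))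
            (DegreeBelow-+ (DegreeBelow-mono (pred-⊗ˡ a b) (DegreeBelow-* duΔ (DegreeBelow-face₁ dv)))
                           (DegreeBelow-mono (pred-⊗ʳ a b) (DegreeBelow-* du₀ dvΔ))))
    where
    Δ-* : ∀ u₁ u₀ v₁ v₀ → u₁ * v₁ - u₀ * v₀ ≈ (u₁ - u₀) * v₁ + u₀ * (v₁ - v₀)
    Δ-* u₁ u₀ v₁ v₀ = x≈y+z⇒x-y≈z (begin
      u₁ * v₁                                ≈⟨ *-cong (x≈y+[x-y] u₁ u₀) refl ⟩
      (u₀ + δu) * v₁                         ≈⟨ distribʳ v₁ u₀ δu ⟩
      u₀ * v₁ + δu * v₁                      ≈⟨ +-cong (*-cong refl (x≈y+[x-y] v₁ v₀)) refl ⟩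
      u₀ * (v₀ + δv) + δu * v₁               ≈⟨ +-cong (distribˡ u₀ v₀ δv) refl ⟩
      (u₀ * v₀ + u₀ * δv) + δu * v₁          ≈⟨ solve 3 (λ a b c → (a :+ b) :+ c := a :+ (c :+ b)) refl (u₀ * v₀) (u₀ * δv) (δu * v₁) ⟩
      u₀ * v₀ + (δu * v₁ + u₀ * δv)          ∎)
      where
      δu = u₁ - u₀
      δv = v₁ - v₀

  DegreeBelow-↑ : ∀ {n d} {v : Vec Bool n → Carrier} m → DegreeBelow (suc d) v → DegreeBelow (suc (m *ℕ d)) (λ a → v a ↑ m)
  DegreeBelow-↑ zero    dv = DegreeBelow-const 1#
  DegreeBelow-↑ (suc m) dv = DegreeBelow-* dv (DegreeBelow-↑ m dv)

  DegreeBelow-linComb : ∀ {n} (α : Vec Carrier n) → DegreeBelow 2 (linComb α)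
  DegreeBelow-linComb []       = constant
  DegreeBelow-linComb (α ∷ αs) =
    split (DegreeBelow-cong (λ a → face₀-linComb (linComb αs a)) (DegreeBelow-linComb αs))
          (DegreeBelow-cong (λ a → sym (x≈y+z⇒x-y≈z (face₁-linComb (linComb αs a)))) (DegreeBelow-const α))
    where
    face₀-linComb : ∀ l → l ≈ α * 0# + l
    face₀-linComb l = solve 2 (λ a l → l := a :* con 0 :+ l) refl α l
    face₁-linComb : ∀ l → α * 1# + l ≈ (α * 0# + l) + α
    face₁-linComb l = solve 2 (λ a l → a :* con 1 :+ l := (a :* con 0 :+ l) :+ a) refl α l

  DegreeBelow-additive : ∀ {n L} {v : Vec Bool n → Carrier} (φ : Carrier → Carrier) →
                         (∀ {x y} → x ≈ y → φ x ≈ φ y) → (∀ x y → φ (x - y) ≈ φ x - φ y) →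
                         DegreeBelow L v → DegreeBelow L (λ a → φ (v a))
  DegreeBelow-additive φ φ-cong φ-homo (vanishes v≈0) = vanishes (begin
    φ _          ≈⟨ φ-cong v≈0 ⟩
    φ 0#         ≈⟨ φ-cong (sym (-‿inverseʳ 0#)) ⟩
    φ (0# - 0#)  ≈⟨ φ-homo 0# 0# ⟩
    φ 0# - φ 0#  ≈⟨ -‿inverseʳ (φ 0#) ⟩
    0#           ∎)
  DegreeBelow-additive φ φ-cong φ-homo constant      = constant
  DegreeBelow-additive φ φ-cong φ-homo (split d₀ dΔ) =
    split (DegreeBelow-additive φ φ-cong φ-homo d₀)
          (DegreeBelow-cong (λ a → φ-homo _ _) (DegreeBelow-additive φ φ-cong φ-homo dΔ))

  sumL-++ : ∀ xs ys → sumL (xs List.++ ys) ≈ sumL xs + sumL ys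
  sumL-++ List.[]       ys = sym (+-identityˡ (sumL ys))
  sumL-++ (x List.∷ xs) ys = trans (+-cong refl (sumL-++ xs ys)) (sym (+-assoc x (sumL xs) (sumL ys)))

  sumL-map-cong : ∀ {A : Set} {g h : A → Carrier} → (∀ a → g a ≈ h a) → ∀ as → sumL (List.map g as) ≈ sumL (List.map h as)
  sumL-map-cong g≈h List.[]       = refl
  sumL-map-cong g≈h (a List.∷ as) = +-cong (g≈h a) (sumL-map-cong g≈h as)

  sumL-*-distribˡ : ∀ {A : Set} x (h : A → Carrier) as → sumL (List.map (λ a → x * h a) as) ≈ x * sumL (List.map h as)
  sumL-*-distribˡ x h List.[]       = sym (zeroʳ x)
  sumL-*-distribˡ x h (a List.∷ as) = trans (+-cong refl (sumL-*-distribˡ x h as)) (sym (distribˡ x (h a) _))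

  eval-∷ : ∀ {n} (f : Multilinear (suc n)) x xs →
           eval f (x ∷ xs) ≈ eval (λ S → f (false ∷ S)) xs + x * eval (λ S → f (true ∷ S)) xs
  eval-∷ {n} f x xs = begin
    sumL (List.map g (List.map (false ∷_) B List.++ List.map (true ∷_) B))
      ≡⟨ cong sumL (List.map-++ g (List.map (false ∷_) B) _) ⟩
    sumL (List.map g (List.map (false ∷_) B) List.++ List.map g (List.map (true ∷_) B))
      ≈⟨ sumL-++ (List.map g (List.map (false ∷_) B)) _ ⟩
    sumL (List.map g (List.map (false ∷_) B)) + sumL (List.map g (List.map (true ∷_) B))
      ≡⟨ cong₂ (λ s t → sumL s + sumL t) (≡.sym (List.map-∘ B)) (≡.sym (List.map-∘ B)) ⟩
    eval (λ S → f (false ∷ S)) xs + sumL (List.map (λ S → f (true ∷ S) * (x * monomial S xs)) B)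
      ≈⟨ +-cong refl (sumL-map-cong (λ S → x∙yz≈y∙xz (f (true ∷ S)) x (monomial S xs)) B) ⟩
    eval (λ S → f (false ∷ S)) xs + sumL (List.map (λ S → x * (f (true ∷ S) * monomial S xs)) B)
      ≈⟨ +-cong refl (sumL-*-distribˡ x (λ S → f (true ∷ S) * monomial S xs) B) ⟩
    eval (λ S → f (false ∷ S)) xs + x * eval (λ S → f (true ∷ S)) xs
      ∎
    where
    B = allBoolVecs n
    g = λ S → f S * monomial S (x ∷ xs)

  eval-0#∷ : ∀ {n} (f : Multilinear (suc n)) xs → eval f (0# ∷ xs) ≈ eval (λ S → f (false ∷ S)) xs
  eval-0#∷ f xs = trans (eval-∷ f 0# xs) (trans (+-cong refl (zeroˡ _)) (+-identityʳ _))

  eval-1#∷-eval-0#∷ : ∀ {n} (f : Multilinear (suc n)) xs →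
                      eval f (1# ∷ xs) - eval f (0# ∷ xs) ≈ eval (λ S → f (true ∷ S)) xs
  eval-1#∷-eval-0#∷ f xs = x≈y+z⇒x-y≈z (begin
    eval f (1# ∷ xs)                                       ≈⟨ eval-∷ f 1# xs ⟩
    eval (λ S → f (false ∷ S)) xs + 1# * eval f₁ xs        ≈⟨ +-cong (sym (eval-0#∷ f xs)) (*-identityˡ _) ⟩
    eval f (0# ∷ xs) + eval f₁ xs                          ∎)
    where f₁ = λ S → f (true ∷ S)

  DegreeBelow⇒coefficient≈0 : ∀ {n L} (f : Multilinear n) → DegreeBelow L (λ a → eval f (map bit a)) →
                              ∀ S → L ≤ weight S → f S ≈ 0#
  DegreeBelow⇒coefficient≈0 f (vanishes f[]≈0) [] z≤n =
    trans (sym (trans (+-identityʳ _) (*-identityʳ _))) f[]≈0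
  DegreeBelow⇒coefficient≈0 f (split d₀ dΔ) (false ∷ S) L≤|S| =
    DegreeBelow⇒coefficient≈0 (λ S → f (false ∷ S)) (DegreeBelow-cong (λ a → eval-0#∷ f (map bit a)) d₀) S L≤|S|
  DegreeBelow⇒coefficient≈0 f (split d₀ dΔ) (true ∷ S) L≤|S| =
    DegreeBelow⇒coefficient≈0 (λ S → f (true ∷ S)) (DegreeBelow-cong (λ a → eval-1#∷-eval-0#∷ f (map bit a)) dΔ) S
                              (ℕ.pred-mono-≤ L≤|S|)

  x↑[a+b*p]≈x↑a*[x↑b]↑p : ∀ x a b p → x ↑ (a +ℕ b *ℕ p) ≈ x ↑ a * (x ↑ b) ↑ p
  x↑[a+b*p]≈x↑a*[x↑b]↑p x a b p = trans (^-homo-* x a (b *ℕ p)) (*-cong refl (sym (^-assocʳ x b p)))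

  module _ {p} (frobenius : ∀ x y → (x - y) ↑ p ≈ x ↑ p - y ↑ p)
           {n} {z : Vec Bool n → Carrier} (z-affine : DegreeBelow 2 z) where

    private
      z↑ : ∀ m → DegreeBelow (suc m) (λ a → z a ↑ m)
      z↑ m = ≡.subst (λ L → DegreeBelow L (λ a → z a ↑ m)) (cong suc (ℕ.*-identityʳ m)) (DegreeBelow-↑ m z-affine)

      frob : ∀ {L} {v : Vec Bool n → Carrier} → DegreeBelow L v → DegreeBelow L (λ a → v a ↑ p)
      frob = DegreeBelow-additive (_↑ p) (^-congˡ p) frobenius

    DegreeBelow-↑[p^j∸1] : 1 ≤ p → ∀ j → DegreeBelow (suc (j *ℕ (p ∸ 1))) (λ a → z a ↑ (p ^ j ∸ 1))
    DegreeBelow-↑[p^j∸1] 1≤p zero    = DegreeBelow-const 1#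
    DegreeBelow-↑[p^j∸1] 1≤p (suc j) =
      DegreeBelow-cong (λ a → sym (trans (^-congʳ (z a) (m*n∸1≡[m∸1]+[n∸1]*m 1≤p (1≤m^n 1≤p j)))
                                         (x↑[a+b*p]≈x↑a*[x↑b]↑p (z a) (p ∸ 1) (p ^ j ∸ 1) p)))
        (DegreeBelow-* (z↑ (p ∸ 1)) (frob (DegreeBelow-↑[p^j∸1] 1≤p j)))

    DegreeBelow-↑[p^[1+j]∸2] : 2 ≤ p → ∀ j → DegreeBelow (suc (suc j *ℕ (p ∸ 1))) (λ a → z a ↑ (p ^ suc j ∸ 2))
    DegreeBelow-↑[p^[1+j]∸2] 2≤p j =
      DegreeBelow-mono (s≤s (ℕ.+-monoˡ-≤ (j *ℕ (p ∸ 1)) (ℕ.∸-monoʳ-≤ p (s≤s z≤n))))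
        (DegreeBelow-cong (λ a → sym (trans (^-congʳ (z a) (m*n∸2≡[m∸2]+[n∸1]*m 2≤p (1≤m^n 1≤p j)))
                                            (x↑[a+b*p]≈x↑a*[x↑b]↑p (z a) (p ∸ 2) (p ^ j ∸ 1) p)))
          (DegreeBelow-* (z↑ (p ∸ 2)) (frob (DegreeBelow-↑[p^j∸1] 1≤p j))))
      where
      1≤p : 1 ≤ p
      1≤p = ℕ.≤-trans (s≤s z≤n) 2≤p

module PrimeCharacteristic {c ℓ} (R : CommutativeRing c ℓ) where
  open CommutativeRing R
  open import Algebra.Properties.AbelianGroup +-abelianGroup using (x≈z//y; //-rightDividesˡ)
  open import Algebra.Properties.Semiring.Exp semiring using (^-congˡ) renaming (_^_ to _↑_)
  open import Algebra.Properties.Semiring.Mult semiring using (_×_; ×1-homo-*; ×-assoc-*; ×-congʳ)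
  import Algebra.Properties.CommutativeSemiring.Binomial commutativeSemiring as Binomial
  open CommutativeMonoidSum +-commutativeMonoid using (sum; sum-init-last; sum-cong-≋; sum-replicate-zero)
  open import Relation.Binary.Reasoning.Setoid setoid

  multiple×≈0 : ∀ {p m} → p × 1# ≈ 0# → p ∣ m → ∀ x → m × x ≈ 0#
  multiple×≈0 {p} p×1≈0 (divides k ≡.refl) x = begin
    (k *ℕ p) × x               ≈⟨ ×-congʳ (k *ℕ p) (sym (*-identityˡ x)) ⟩
    (k *ℕ p) × (1# * x)        ≈⟨ sym (×-assoc-* (k *ℕ p) 1# x) ⟩
    ((k *ℕ p) × 1#) * x        ≈⟨ *-cong (×1-homo-* k p) refl ⟩
    ((k × 1#) * (p × 1#)) * x  ≈⟨ *-cong (*-cong refl p×1≈0) refl ⟩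
    ((k × 1#) * 0#) * x        ≈⟨ *-cong (zeroʳ _) refl ⟩
    0# * x                     ≈⟨ zeroˡ x ⟩
    0#                         ∎

  frobenius-+ : ∀ {p} → Prime p → p × 1# ≈ 0# → ∀ x y → (x + y) ↑ p ≈ x ↑ p + y ↑ p
  frobenius-+ {suc n} p-prime p×1≈0 x y = begin
    (x + y) ↑ suc n                                                    ≈⟨ Binomial.theorem (suc n) x y ⟩
    t fzero + sum (λ j → t (fsuc j))                                   ≈⟨ +-cong refl (sum-init-last (λ j → t (fsuc j))) ⟩
    t fzero + (sum (λ j → t (fsuc (inject₁ j))) + t (fsuc (fromℕ n)))  ≈⟨ +-cong first (+-cong middle (last (Fin.toℕ-fromℕ n))) ⟩
    y ↑ suc n + (0# + x ↑ suc n)                                       ≈⟨ +-comm _ _ ⟩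
    (0# + x ↑ suc n) + y ↑ suc n                                       ≈⟨ +-cong (+-identityˡ _) refl ⟩
    x ↑ suc n + y ↑ suc n                                              ∎
    where
    t = Binomial.binomialTerm x y (suc n)
    first : t fzero ≈ y ↑ suc n
    first = trans (+-identityʳ _) (*-identityˡ _)
    middle : sum (λ j → t (fsuc (inject₁ j))) ≈ 0#
    middle = trans (sum-cong-≋ (λ j → multiple×≈0 p×1≈0 (prime∣pCk p-prime (s≤s z≤n) (s≤s (inject₁<n j))) _))
                   (sum-replicate-zero n)
      where
      inject₁<n : ∀ j → toℕ (inject₁ j) < n
      inject₁<n j = ≡.subst (_< n) (≡.sym (Fin.toℕ-inject₁ j)) (Fin.toℕ<n j)
    last : ∀ {k} → k ≡ n → (suc n C suc k) × (x ↑ suc k * y ↑ (n ∸ k)) ≈ x ↑ suc n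
    last ≡.refl rewrite nCn≡1 (suc n) | ℕ.n∸n≡0 n = trans (+-identityʳ _) (*-identityʳ _)

  frobenius-- : ∀ {p} → Prime p → p × 1# ≈ 0# → ∀ x y → (x - y) ↑ p ≈ x ↑ p - y ↑ p
  frobenius-- {p} p-prime p×1≈0 x y = x≈z//y ((x - y) ↑ p) (y ↑ p) (x ↑ p) (begin
    (x - y) ↑ p + y ↑ p    ≈⟨ sym (frobenius-+ p-prime p×1≈0 (x - y) y) ⟩
    ((x - y) + y) ↑ p      ≈⟨ ^-congˡ p (//-rightDividesˡ y x) ⟩
    x ↑ p                  ∎)

module FieldProperties {c ℓ} {R : CommutativeRing c ℓ} (isField : IsField R) where
  open CommutativeRing R
  open IsField isField
  open import Algebra.Properties.Ring ring using (-‿distribʳ-*)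
  open import Algebra.Properties.AbelianGroup +-abelianGroup using (x∙y⁻¹≈ε⇒x≈y)
  open import Relation.Binary.Reasoning.Setoid setoid

  x≉0∧x*y≈0⇒y≈0 : ∀ {x y} → x ≉ 0# → x * y ≈ 0# → y ≈ 0#
  x≉0∧x*y≈0⇒y≈0 {x} {y} x≉0 x*y≈0 = begin
    y              ≈⟨ sym (*-identityˡ y) ⟩
    1# * y         ≈⟨ *-cong (sym (trans (*-comm x⁻¹ x) (proj₂ (inverse x x≉0)))) refl ⟩
    (x⁻¹ * x) * y  ≈⟨ *-assoc x⁻¹ x y ⟩
    x⁻¹ * (x * y)  ≈⟨ *-cong refl x*y≈0 ⟩
    x⁻¹ * 0#       ≈⟨ zeroʳ x⁻¹ ⟩
    0#             ∎
    where x⁻¹ = proj₁ (inverse x x≉0)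

  *-≉0 : ∀ {x y} → x ≉ 0# → y ≉ 0# → x * y ≉ 0#
  *-≉0 x≉0 y≉0 x*y≈0 = y≉0 (x≉0∧x*y≈0⇒y≈0 x≉0 x*y≈0)

  *-cancelˡ-≉0 : ∀ {x y z} → x ≉ 0# → x * y ≈ x * z → y ≈ z
  *-cancelˡ-≉0 {x} {y} {z} x≉0 xy≈xz = x∙y⁻¹≈ε⇒x≈y y z (x≉0∧x*y≈0⇒y≈0 x≉0 (begin
    x * (y - z)        ≈⟨ distribˡ x y (- z) ⟩
    x * y + x * - z    ≈⟨ +-cong xy≈xz (sym (-‿distribʳ-* x z)) ⟩
    x * z - x * z      ≈⟨ -‿inverseʳ (x * z) ⟩
    0#                 ∎))

module FiniteFieldProperties {c ℓ q} (F : FiniteField c ℓ q) where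
  open FiniteField F
  open IsField isField
  open HasCardinality cardinality
  open FieldProperties isField
  open import Algebra.Properties.AbelianGroup +-abelianGroup using (identityˡ-unique; \\-leftDividesˡ; \\-leftDividesʳ)
  open import Algebra.Properties.Semiring.Exp semiring using () renaming (_^_ to _↑_)
  open import Algebra.Properties.Semiring.Mult semiring using (_×_; ×1-homo-*)
  module Σ+ = CommutativeMonoidSum +-commutativeMonoid
  module Π = CommutativeMonoidSum *-commutativeMonoid
  open import Relation.Binary.Reasoning.Setoid setoid

  toFin-injective : ∀ {x y} → toFin x ≡ toFin y → x ≈ y
  toFin-injective {x} {y} eq = trans (sym (from-to x)) (trans (reflexive (cong fromFin eq)) (from-to y))

  _≟_ : Decidable _≈_
  x ≟ y with toFin x Fin.≟ toFin y
  ... | yes eq = yes (toFin-injective eq)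
  ... | no neq = no (λ x≈y → neq (toFin-cong x≈y))

  2≤q : 2 ≤ q
  2≤q = distinct⇒2≤n {i = toFin 0#} {toFin 1#} (λ eq → 0≉1 (toFin-injective eq))

  carrierPermutation : (h h⁻¹ : Carrier → Carrier) →
                       (∀ {x y} → x ≈ y → h x ≈ h y) → (∀ {x y} → x ≈ y → h⁻¹ x ≈ h⁻¹ y) →
                       (∀ x → h (h⁻¹ x) ≈ x) → (∀ x → h⁻¹ (h x) ≈ x) → Permutation q q
  carrierPermutation h h⁻¹ h-cong h⁻¹-cong h∘h⁻¹ h⁻¹∘h = permutation
    (λ i → toFin (h (fromFin i)))
    (λ i → toFin (h⁻¹ (fromFin i)))
    (λ i → ≡.trans (toFin-cong (trans (h-cong (from-to _)) (h∘h⁻¹ _))) (to-from i))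
    (λ i → ≡.trans (toFin-cong (trans (h⁻¹-cong (from-to _)) (h⁻¹∘h _))) (to-from i))

  -- Translating every element by x permutes the field, so Σ_y y = Σ_y (x + y) = q × x + Σ_y y.
  q×x≈0 : ∀ x → q × x ≈ 0#
  q×x≈0 x = identityˡ-unique (q × x) S (sym (begin
    S                                         ≈⟨ Σ+.sum-permute fromFin π ⟩
    Σ+.sum (λ i → fromFin (toFin (x + fromFin i))) ≈⟨ Σ+.sum-cong-≋ {q} (λ i → from-to _) ⟩
    Σ+.sum (λ i → x + fromFin i)              ≈⟨ Σ+.∑-distrib-+ (λ _ → x) fromFin ⟩
    Σ+.sum {q} (λ _ → x) + S                  ≈⟨ +-cong (Σ+.sum-replicate q) refl ⟩
    q × x + S                                 ∎))
    where
    S = Σ+.sum fromFin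
    π = carrierPermutation (x +_) (- x +_) (+-cong refl) (+-cong refl) (\\-leftDividesˡ x) (\\-leftDividesʳ x)

  ↑≈0⇒≈0 : ∀ {x} k → x ↑ k ≈ 0# → x ≈ 0#
  ↑≈0⇒≈0     zero    1≈0    = ⊥-elim (0≉1 (sym 1≈0))
  ↑≈0⇒≈0 {x} (suc k) xᵏ⁺¹≈0 with x ≟ 0#
  ... | yes x≈0 = x≈0
  ... | no  x≉0 = ↑≈0⇒≈0 k (x≉0∧x*y≈0⇒y≈0 x≉0 xᵏ⁺¹≈0)

  m^n×1≈[m×1]↑n : ∀ m n → (m ^ n) × 1# ≈ (m × 1#) ↑ n
  m^n×1≈[m×1]↑n m zero    = +-identityʳ 1#
  m^n×1≈[m×1]↑n m (suc n) = trans (×1-homo-* m (m ^ n)) (*-cong refl (m^n×1≈[m×1]↑n m n))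

  characteristic : ∀ {p k} → q ≡ p ^ k → p × 1# ≈ 0#
  characteristic {p} {k} q≡pᵏ = ↑≈0⇒≈0 k (begin
    (p × 1#) ↑ k  ≈⟨ sym (m^n×1≈[m×1]↑n p k) ⟩
    (p ^ k) × 1#  ≡⟨ cong (_× 1#) (≡.sym q≡pᵏ) ⟩
    q × 1#        ≈⟨ q×x≈0 1# ⟩
    0#            ∎)

  ∏-≉0 : ∀ {N} (w : Fin N → Carrier) → (∀ j → w j ≉ 0#) → Π.sum w ≉ 0#
  ∏-≉0 {zero}  w w≉0 1≈0 = 0≉1 (sym 1≈0)
  ∏-≉0 {suc N} w w≉0     = *-≉0 (w≉0 fzero) (∏-≉0 (λ j → w (fsuc j)) (λ j → w≉0 (fsuc j)))

  scaling-permutation⇒↑≈1 : ∀ {N x} (w : Fin N → Carrier) (σ : Permutation N N) →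
                            (∀ j → w j ≉ 0#) → (∀ j → w (σ ⟨$⟩ʳ j) ≈ x * w j) → x ↑ N ≈ 1#
  scaling-permutation⇒↑≈1 {N} {x} w σ w≉0 w∘σ≈x*w = *-cancelˡ-≉0 (∏-≉0 w w≉0) (begin
    P * x ↑ N                     ≈⟨ *-comm P _ ⟩
    x ↑ N * P                     ≈⟨ *-cong (sym (Π.sum-replicate N)) refl ⟩
    Π.sum {N} (λ _ → x) * P       ≈⟨ sym (Π.∑-distrib-+ (λ _ → x) w) ⟩
    Π.sum (λ j → x * w j)         ≈⟨ sym (Π.sum-cong-≋ {N} w∘σ≈x*w) ⟩
    Π.sum (λ j → w (σ ⟨$⟩ʳ j))    ≈⟨ sym (Π.sum-permute w σ) ⟩
    P                             ≈⟨ sym (*-identityʳ P) ⟩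
    P * 1#                        ∎)
    where P = Π.sum w

  scaling-permutation-fixing⇒↑≈1 : ∀ {n m x} → n ≡ suc m → (w : Fin n → Carrier) (π : Permutation n n) (i₀ : Fin n) →
                                   π ⟨$⟩ʳ i₀ ≡ i₀ → (∀ j → ¬ j ≡ i₀ → w j ≉ 0#) → (∀ j → w (π ⟨$⟩ʳ j) ≈ x * w j) →
                                   x ↑ m ≈ 1#
  scaling-permutation-fixing⇒↑≈1 ≡.refl w π i₀ π[i₀]≡i₀ w≉0 w∘π≈x*w =
    scaling-permutation⇒↑≈1 (λ j → w (punchIn i₀ j)) σ
      (λ j → w≉0 (punchIn i₀ j) (Fin.punchInᵢ≢i i₀ j))
      (λ j → trans (reflexive (cong w (punchIn-σ j))) (w∘π≈x*w (punchIn i₀ j)))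
    where
    σ = Permutation.remove i₀ π
    punchIn-σ : ∀ j → punchIn i₀ (σ ⟨$⟩ʳ j) ≡ π ⟨$⟩ʳ punchIn i₀ j
    punchIn-σ j = ≡.trans (cong (λ i → punchIn i (σ ⟨$⟩ʳ j)) (≡.sym π[i₀]≡i₀))
                          (≡.sym (Permutation.punchIn-permute π i₀ j))

  -- Multiplication by x ≉ 0 permutes the nonzero elements.
  fermat : ∀ {x} → x ≉ 0# → x ↑ (q ∸ 1) ≈ 1#
  fermat {x} x≉0 = scaling-permutation-fixing⇒↑≈1 q≡1+[q∸1] fromFin π (toFin 0#) π[0]≡0 fromFin≉0 (λ j → from-to _)
    where
    x⁻¹ = proj₁ (inverse x x≉0)
    x*x⁻¹≈1 = proj₂ (inverse x x≉0)
    π = carrierPermutation (x *_) (x⁻¹ *_) (*-cong refl) (*-cong refl)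
          (λ y → trans (sym (*-assoc _ _ _)) (trans (*-cong x*x⁻¹≈1 refl) (*-identityˡ y)))
          (λ y → trans (sym (*-assoc _ _ _)) (trans (*-cong (trans (*-comm x⁻¹ x) x*x⁻¹≈1) refl) (*-identityˡ y)))
    q≡1+[q∸1] : q ≡ suc (q ∸ 1)
    q≡1+[q∸1] = ≡.sym (ℕ.suc-pred q {{>-nonZero (ℕ.≤-trans (s≤s z≤n) 2≤q)}})
    π[0]≡0 : toFin (x * fromFin (toFin 0#)) ≡ toFin 0#
    π[0]≡0 = toFin-cong (trans (*-cong refl (from-to 0#)) (zeroʳ x))
    fromFin≉0 : ∀ j → ¬ j ≡ toFin 0# → fromFin j ≉ 0#
    fromFin≉0 j j≢0 j≈0 = j≢0 (≡.trans (≡.sym (to-from j)) (toFin-cong j≈0))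

  inverse≈↑[q∸2] : ∀ {x y} → x ≉ 0# → y * x ≈ 1# → y ≈ x ↑ (q ∸ 2)
  inverse≈↑[q∸2] {x} {y} x≉0 y*x≈1 = *-cancelˡ-≉0 x≉0 (begin
    x * y                ≈⟨ *-comm x y ⟩
    y * x                ≈⟨ y*x≈1 ⟩
    1#                   ≈⟨ sym (fermat x≉0) ⟩
    x ↑ (q ∸ 1)          ≡⟨ cong (x ↑_) (≡.sym (suc[n∸2]≡n∸1 2≤q)) ⟩
    x * x ↑ (q ∸ 2)      ∎)

mainTheorem11 : ∀ {c ℓ} (p k : ℕ) → Prime p → (F : FiniteField c ℓ (p ^ k)) →
    let open FiniteField F in let open Poly commRing in
    (n : ℕ) (α : Vec Carrier n) (β : Carrier) →
    (∀ (a : Vec Bool n) → ¬ (linComb α a - β ≈ 0#)) →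
    (f : Multilinear n) →
    (∀ (a : Vec Bool n) → eval f (map bit a) * (linComb α a - β) ≈ 1#) →
    DegreeAtMost f (k *ℕ (p ∸ 1))
mainTheorem11 p zero    p-prime F = ⊥-elim (ℕ.<-irrefl ≡.refl (FiniteFieldProperties.2≤q F))
mainTheorem11 p (suc k) p-prime F n α β z≉0 f f*z≈1 =
  DegreeBelow⇒coefficient≈0 f
    (DegreeBelow-cong (λ a → sym (inverse≈↑[q∸2] (z≉0 a) (f*z≈1 a)))
                      (DegreeBelow-↑[p^[1+j]∸2] (frobenius-- p-prime (characteristic {p} {suc k} ≡.refl)) z-affine 2≤p k))
  where
  open FiniteField F
  open Poly commRing
  open CubeDegree commRing
  open PrimeCharacteristic commRing using (frobenius--)
  open FiniteFieldProperties F using (characteristic; inverse≈↑[q∸2])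

  z-affine : DegreeBelow 2 (λ a → linComb α a - β)
  z-affine = DegreeBelow-+ (DegreeBelow-linComb α) (DegreeBelow-mono (s≤s z≤n) (DegreeBelow-const (- β)))

  2≤p : 2 ≤ p
  2≤p = nonTrivial⇒n>1 p {{prime⇒nonTrivial p-prime}}
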